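{- Let $m\ge n$ and let $u_1,\dots,u_m\in\mathbb{R}^n$ be points such that strictly more than $\frac{d}{n}m$ of them (the inliers) lie in a $d$-dimensional linear subspace $T$. Let $V$ be a uniformly random subset of $n$ of the points (without repetition). Then the probability $p$ that $V$ contains at least $d+1$ inliers satisfies $p\ge\frac{1}{2n^2m}$. -}

module Defs where

open import Data.Nat using (ℕ; zero; suc; _≤_; _<?_; _≟_)
open import Data.Bool using (Bool; true; false)
open import Data.Vec using (Vec; []; _∷_; tabulate)
open import Data.List using (List; []; _∷_; map; _++_; length; filter)
open import Data.Fin using (Fin)
open import Data.Fin.Subset using (Subset; _∩_; ∣_∣)
open import Relation.Nullary using (Dec; does)
open import Relation.Unary using (Pred; Decidable)
open import Level using (Level)

allSubsets : (m : ℕ) → List (Subset m)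
allSubsets zero = [] ∷ []
allSubsets (suc m) = map (false ∷_) (allSubsets m) ++ map (true ∷_) (allSubsets m)

-- All n-element subsets of Fin m (the sample space of V, uniform).
nSubsets : (m n : ℕ) → List (Subset m)
nSubsets m n = filter (λ V → ∣ V ∣ ≟ n) (allSubsets m)

inliers : ∀ {a ℓ} {X : Set a} {m : ℕ} (T : Pred X ℓ) → Decidable T →
          (Fin m → X) → Subset m
inliers T T? u = tabulate (λ i → does (T? (u i)))

goodCount : (m n d : ℕ) → Subset m → ℕ
goodCount m n d I = length (filter (λ V → d <? ∣ V ∩ I ∣) (nSubsets m n))

-- Double counting over the n-subsets V of the m points: every inlier lies in a
-- fraction n/m of them, so the total Σ_V |V ∩ I| equals (n |I| / m) · C(m, n),
-- which exceeds d · C(m, n) by at least C(m, n) / m because d m < n |I| are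
-- integers.  On the other hand |V ∩ I| ≤ d unless V is good, and |V ∩ I| ≤ n
-- always, so the total is at most d · C(m, n) + n · #good.  Hence
-- C(m, n) ≤ m n · #good ≤ 2 n² m · #good.
module Submission where

open import Level using (Level)
open import Function using (_∘_)
open import Data.Bool using (true; false)
open import Data.Nat using (ℕ; zero; suc; _+_; _*_; _^_; _≤_; _<_; _≟_; _<?_; z≤n)
open import Data.Nat.Properties
open import Data.Nat.ListAction using (sum)
open import Data.Nat.ListAction.Properties using (sum-++)
open import Data.Nat.Tactic.RingSolver using (solve-∀)
open import Algebra.Properties.CommutativeSemigroup +-commutativeSemigroup
  using () renaming (x∙yz≈y∙xz to +-left-comm)
open import Algebra.Properties.CommutativeSemigroup *-commutativeSemigroup
  using () renaming (x∙yz≈y∙xz to *-left-comm)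
open import Data.Fin using (Fin)
open import Data.Fin.Subset using (Subset; _∩_; ∣_∣; ⊥; inside; outside)
open import Data.Fin.Subset.Properties using (∣p∩q∣≤∣p∣; ∩-zeroˡ; ∣⊥∣≡0)
open import Data.Vec using (_∷_; [])
open import Data.List using (List; []; _∷_; map; _++_; length; filter)
open import Data.List.Properties
  using (map-++; map-∘; length-++; length-map; filter-++; filter-none)
open import Data.List.Relation.Unary.All as All using (All; []; _∷_)
open import Data.List.Relation.Unary.All.Properties using (all-filter)
open import Relation.Nullary using (Dec; yes; no; does; ¬_)
open import Relation.Unary using (Pred; Decidable)
open import Relation.Binary.PropositionalEquality

open import Defs

private variable
  a p : Level
  A B : Set a

∑ : List A → (A → ℕ) → ℕ
∑ xs f = sum (map f xs)

∑-++ : ∀ xs ys (f : A → ℕ) → ∑ (xs ++ ys) f ≡ ∑ xs f + ∑ ys f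
∑-++ xs ys f = trans (cong sum (map-++ f xs ys)) (sum-++ (map f xs) (map f ys))

∑-map : ∀ (g : A → B) xs (f : B → ℕ) → ∑ (map g xs) f ≡ ∑ xs (f ∘ g)
∑-map g xs f = cong sum (sym (map-∘ xs))

∑-suc : ∀ xs (f : A → ℕ) → ∑ xs (suc ∘ f) ≡ length xs + ∑ xs f
∑-suc []       f = refl
∑-suc (x ∷ xs) f = begin
  suc (f x) + ∑ xs (suc ∘ f)         ≡⟨ cong (suc (f x) +_) (∑-suc xs f) ⟩
  suc (f x + (length xs + ∑ xs f))   ≡⟨ cong suc (+-left-comm (f x) (length xs) (∑ xs f)) ⟩
  suc (length xs + (f x + ∑ xs f))   ∎
  where open ≡-Reasoning

∑-≤-filter-split : ∀ {P : Pred A p} (P? : Decidable P) {d n} (f : A → ℕ) →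
                   (∀ x → ¬ P x → f x ≤ d) → ∀ xs → All (λ x → f x ≤ n) xs →
                   ∑ xs f ≤ d * length xs + n * length (filter P? xs)
∑-≤-filter-split P?         f ¬P⇒f≤d []       []            = z≤n
∑-≤-filter-split P? {d} {n} f ¬P⇒f≤d (x ∷ xs) (fx≤n ∷ xs≤n) with P? x
  | ∑-≤-filter-split P? f ¬P⇒f≤d xs xs≤n
... | yes _  | ih = begin
  f x + ∑ xs f                                          ≤⟨ +-mono-≤ fx≤n ih ⟩
  n + (d * length xs + n * length (filter P? xs))       ≤⟨ m≤n+m _ d ⟩
  d + (n + (d * length xs + n * length (filter P? xs))) ≡⟨ rearrange d n _ _ ⟩
  d * suc (length xs) + n * suc (length (filter P? xs)) ∎
  where open ≤-Reasoning
        rearrange : ∀ d n l c → d + (n + (d * l + n * c)) ≡ d * suc l + n * suc c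
        rearrange = solve-∀
... | no ¬px | ih = begin
  f x + ∑ xs f                                        ≤⟨ +-mono-≤ (¬P⇒f≤d x ¬px) ih ⟩
  d + (d * length xs + n * length (filter P? xs))     ≡⟨ rearrange d n _ _ ⟩
  d * suc (length xs) + n * length (filter P? xs)     ∎
  where open ≤-Reasoning
        rearrange : ∀ d n l c → d + (d * l + n * c) ≡ d * suc l + n * c
        rearrange = solve-∀

filter-map : ∀ {q} {P : Pred B p} {Q : Pred A q} (P? : Decidable P) (Q? : Decidable Q)
             (g : A → B) → (∀ x → does (P? (g x)) ≡ does (Q? x)) →
             ∀ xs → filter P? (map g xs) ≡ map g (filter Q? xs)
filter-map P? Q? g same []       = refl
filter-map P? Q? g same (x ∷ xs) with does (P? (g x)) | does (Q? x) | same x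
... | true  | true  | refl = cong (g x ∷_) (filter-map P? Q? g same xs)
... | false | false | refl = filter-map P? Q? g same xs

nSubsets-suc : ∀ m n → nSubsets (suc m) (suc n) ≡
               map (outside ∷_) (nSubsets m (suc n)) ++ map (inside ∷_) (nSubsets m n)
nSubsets-suc m n = begin
  filter P? (map (outside ∷_) S ++ map (inside ∷_) S)
    ≡⟨ filter-++ P? (map (outside ∷_) S) _ ⟩
  filter P? (map (outside ∷_) S) ++ filter P? (map (inside ∷_) S)
    ≡⟨ cong₂ _++_ (filter-map P? _ (outside ∷_) (λ _ → refl) S)
                  (filter-map P? _ (inside ∷_) (λ _ → refl) S) ⟩
  map (outside ∷_) (nSubsets m (suc n)) ++ map (inside ∷_) (nSubsets m n) ∎
  where open ≡-Reasoning
        S : List (Subset m)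
        S = allSubsets m
        P? : (V : Subset (suc m)) → Dec (∣ V ∣ ≡ suc n)
        P? V = ∣ V ∣ ≟ suc n

nSubsets-zero : ∀ m → nSubsets m 0 ≡ ⊥ ∷ []
nSubsets-zero zero    = refl
nSubsets-zero (suc m) = begin
  filter P? (map (outside ∷_) S ++ map (inside ∷_) S)
    ≡⟨ filter-++ P? (map (outside ∷_) S) _ ⟩
  filter P? (map (outside ∷_) S) ++ filter P? (map (inside ∷_) S)
    ≡⟨ cong₂ _++_ (filter-map P? _ (outside ∷_) (λ _ → refl) S)
                  (filter-map P? Q? (inside ∷_) (λ _ → refl) S) ⟩
  map (outside ∷_) (nSubsets m 0) ++ map (inside ∷_) (filter Q? S)
    ≡⟨ cong₂ (λ xs ys → map (outside ∷_) xs ++ map (inside ∷_) ys)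
             (nSubsets-zero m) (filter-none Q? (All.universal (λ _ ()) S)) ⟩
  ⊥ ∷ [] ∎
  where open ≡-Reasoning
        S : List (Subset m)
        S = allSubsets m
        P? : (V : Subset (suc m)) → Dec (∣ V ∣ ≡ 0)
        P? V = ∣ V ∣ ≟ 0
        Q? : (V : Subset m) → Dec (suc ∣ V ∣ ≡ 0)
        Q? V = suc ∣ V ∣ ≟ 0

binomial : ℕ → ℕ → ℕ
binomial m n = length (nSubsets m n)

binomial-zero : ∀ m → binomial m 0 ≡ 1
binomial-zero m = cong length (nSubsets-zero m)

binomial-pascal : ∀ m n → binomial (suc m) (suc n) ≡ binomial m (suc n) + binomial m n
binomial-pascal m n = begin
  length (nSubsets (suc m) (suc n))
    ≡⟨ cong length (nSubsets-suc m n) ⟩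
  length (map (outside ∷_) (nSubsets m (suc n)) ++ map (inside ∷_) (nSubsets m n))
    ≡⟨ length-++ (map (outside ∷_) (nSubsets m (suc n))) ⟩
  length (map (outside ∷_) (nSubsets m (suc n))) + length (map (inside ∷_) (nSubsets m n))
    ≡⟨ cong₂ _+_ (length-map _ (nSubsets m (suc n))) (length-map _ (nSubsets m n)) ⟩
  binomial m (suc n) + binomial m n ∎
  where open ≡-Reasoning

binomial-one : ∀ m → binomial m 1 ≡ m
binomial-one zero    = refl
binomial-one (suc m) = begin
  binomial (suc m) 1          ≡⟨ binomial-pascal m 0 ⟩
  binomial m 1 + binomial m 0 ≡⟨ cong₂ _+_ (binomial-one m) (binomial-zero m) ⟩
  m + 1                       ≡⟨ +-comm m 1 ⟩
  suc m                       ∎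
  where open ≡-Reasoning

binomial-absorption : ∀ m n → suc n * binomial (suc m) (suc n) ≡ suc m * binomial m n
binomial-absorption m       zero    = begin
  1 * binomial (suc m) 1 ≡⟨ *-identityˡ _ ⟩
  binomial (suc m) 1     ≡⟨ binomial-one (suc m) ⟩
  suc m                  ≡⟨ *-identityʳ (suc m) ⟨
  suc m * 1              ≡⟨ cong (suc m *_) (binomial-zero m) ⟨
  suc m * binomial m 0   ∎
  where open ≡-Reasoning
binomial-absorption zero    (suc n) = *-zeroʳ (suc (suc n))
binomial-absorption (suc m) (suc n) = begin
  suc k * C (suc (suc m)) (suc k)
    ≡⟨ cong (suc k *_) (binomial-pascal (suc m) k) ⟩
  suc k * (C (suc m) (suc k) + C (suc m) k)
    ≡⟨ distrib-suc k (C (suc m) (suc k)) (C (suc m) k) ⟩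
  suc k * C (suc m) (suc k) + k * C (suc m) k + C (suc m) k
    ≡⟨ cong₂ (λ x y → x + y + C (suc m) k) (binomial-absorption m k) (binomial-absorption m n) ⟩
  suc m * C m k + suc m * C m n + C (suc m) k
    ≡⟨ cong (_+ C (suc m) k) (*-distribˡ-+ (suc m) (C m k) (C m n)) ⟨
  suc m * (C m k + C m n) + C (suc m) k
    ≡⟨ cong (λ x → suc m * x + C (suc m) k) (binomial-pascal m n) ⟨
  suc m * C (suc m) k + C (suc m) k
    ≡⟨ +-comm (suc m * C (suc m) k) _ ⟩
  suc (suc m) * C (suc m) k ∎
  where open ≡-Reasoning
        C : ℕ → ℕ → ℕ
        C = binomial
        k : ℕ
        k = suc n
        distrib-suc : ∀ k x y → suc k * (x + y) ≡ suc k * x + k * y + y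
        distrib-suc = solve-∀

∣x∷p∣≡∣x∷[]∣+∣p∣ : ∀ {n} x (p : Subset n) → ∣ x ∷ p ∣ ≡ ∣ x ∷ [] ∣ + ∣ p ∣
∣x∷p∣≡∣x∷[]∣+∣p∣ outside p = refl
∣x∷p∣≡∣x∷[]∣+∣p∣ inside  p = refl

∑-∣x∷∣ : ∀ {n} x xs (f : A → Subset n) →
         ∑ xs (λ y → ∣ x ∷ f y ∣) ≡ ∣ x ∷ [] ∣ * length xs + ∑ xs (∣_∣ ∘ f)
∑-∣x∷∣ outside xs f = refl
∑-∣x∷∣ inside  xs f =
  trans (∑-suc xs (∣_∣ ∘ f)) (cong (_+ ∑ xs (∣_∣ ∘ f)) (sym (*-identityˡ (length xs))))

totalOverlap : ∀ m → ℕ → Subset m → ℕ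
totalOverlap m n I = ∑ (nSubsets m n) (λ V → ∣ V ∩ I ∣)

totalOverlap-zero : ∀ m (I : Subset m) → totalOverlap m 0 I ≡ 0
totalOverlap-zero m I = begin
  ∑ (nSubsets m 0) (λ V → ∣ V ∩ I ∣) ≡⟨ cong (λ xs → ∑ xs (λ V → ∣ V ∩ I ∣)) (nSubsets-zero m) ⟩
  ∣ ⊥ ∩ I ∣ + 0                       ≡⟨ cong (λ V → ∣ V ∣ + 0) (∩-zeroˡ I) ⟩
  ∣ ⊥ {m} ∣ + 0                       ≡⟨ cong (_+ 0) (∣⊥∣≡0 m) ⟩
  0                                   ∎
  where open ≡-Reasoning

totalOverlap-suc : ∀ m n x (I : Subset m) →
                   totalOverlap (suc m) (suc n) (x ∷ I) ≡
                   totalOverlap m (suc n) I + (∣ x ∷ [] ∣ * binomial m n + totalOverlap m n I)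
totalOverlap-suc m n x I = begin
  ∑ (nSubsets (suc m) (suc n)) f
    ≡⟨ cong (λ xs → ∑ xs f) (nSubsets-suc m n) ⟩
  ∑ (map (outside ∷_) (nSubsets m (suc n)) ++ map (inside ∷_) (nSubsets m n)) f
    ≡⟨ ∑-++ (map (outside ∷_) (nSubsets m (suc n))) _ f ⟩
  ∑ (map (outside ∷_) (nSubsets m (suc n))) f + ∑ (map (inside ∷_) (nSubsets m n)) f
    ≡⟨ cong₂ _+_ (∑-map (outside ∷_) (nSubsets m (suc n)) f) (∑-map (inside ∷_) (nSubsets m n) f) ⟩
  totalOverlap m (suc n) I + ∑ (nSubsets m n) (λ V → ∣ x ∷ (V ∩ I) ∣)
    ≡⟨ cong (totalOverlap m (suc n) I +_) (∑-∣x∷∣ x (nSubsets m n) (_∩ I)) ⟩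
  totalOverlap m (suc n) I + (∣ x ∷ [] ∣ * binomial m n + totalOverlap m n I) ∎
  where open ≡-Reasoning
        f : Subset (suc m) → ℕ
        f V = ∣ V ∩ (x ∷ I) ∣

-- Each element of an (m+1)-set lies in exactly C(m, n) of its (n+1)-subsets.
totalOverlap≡∣I∣*binomial : ∀ m n (I : Subset (suc m)) →
                            totalOverlap (suc m) (suc n) I ≡ ∣ I ∣ * binomial m n
totalOverlap≡∣I∣*binomial zero    zero    (outside ∷ []) = refl
totalOverlap≡∣I∣*binomial zero    zero    (inside  ∷ []) = refl
totalOverlap≡∣I∣*binomial zero    (suc n) (outside ∷ []) = refl
totalOverlap≡∣I∣*binomial zero    (suc n) (inside  ∷ []) = refl
totalOverlap≡∣I∣*binomial (suc m) n       (x ∷ I)        = begin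
  totalOverlap (suc (suc m)) (suc n) (x ∷ I)
    ≡⟨ totalOverlap-suc (suc m) n x I ⟩
  totalOverlap (suc m) (suc n) I + (∣ x ∷ [] ∣ * C (suc m) n + totalOverlap (suc m) n I)
    ≡⟨ cong (_+ (∣ x ∷ [] ∣ * C (suc m) n + totalOverlap (suc m) n I))
            (totalOverlap≡∣I∣*binomial m n I) ⟩
  ∣ I ∣ * C m n + (∣ x ∷ [] ∣ * C (suc m) n + totalOverlap (suc m) n I)
    ≡⟨ +-left-comm (∣ I ∣ * C m n) (∣ x ∷ [] ∣ * C (suc m) n) (totalOverlap (suc m) n I) ⟩
  ∣ x ∷ [] ∣ * C (suc m) n + (∣ I ∣ * C m n + totalOverlap (suc m) n I)
    ≡⟨ cong (∣ x ∷ [] ∣ * C (suc m) n +_) (shift n) ⟩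
  ∣ x ∷ [] ∣ * C (suc m) n + ∣ I ∣ * C (suc m) n
    ≡⟨ *-distribʳ-+ (C (suc m) n) ∣ x ∷ [] ∣ ∣ I ∣ ⟨
  (∣ x ∷ [] ∣ + ∣ I ∣) * C (suc m) n
    ≡⟨ cong (_* C (suc m) n) (∣x∷p∣≡∣x∷[]∣+∣p∣ x I) ⟨
  ∣ x ∷ I ∣ * C (suc m) n ∎
  where
  open ≡-Reasoning
  C : ℕ → ℕ → ℕ
  C = binomial
  shift : ∀ n → ∣ I ∣ * C m n + totalOverlap (suc m) n I ≡ ∣ I ∣ * C (suc m) n
  shift zero    rewrite binomial-zero m | binomial-zero (suc m) | totalOverlap-zero (suc m) I =
    +-identityʳ (∣ I ∣ * 1)
  shift (suc n) = begin
    ∣ I ∣ * C m (suc n) + totalOverlap (suc m) (suc n) I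
      ≡⟨ cong (∣ I ∣ * C m (suc n) +_) (totalOverlap≡∣I∣*binomial m n I) ⟩
    ∣ I ∣ * C m (suc n) + ∣ I ∣ * C m n
      ≡⟨ *-distribˡ-+ ∣ I ∣ (C m (suc n)) (C m n) ⟨
    ∣ I ∣ * (C m (suc n) + C m n)
      ≡⟨ cong (∣ I ∣ *_) (binomial-pascal m n) ⟨
    ∣ I ∣ * C (suc m) (suc n) ∎

m*totalOverlap≡n*∣I∣*binomial : ∀ m n (I : Subset m) →
                                m * totalOverlap m n I ≡ n * ∣ I ∣ * binomial m n
m*totalOverlap≡n*∣I∣*binomial m       zero    I  =
  trans (cong (m *_) (totalOverlap-zero m I)) (*-zeroʳ m)
m*totalOverlap≡n*∣I∣*binomial zero    (suc n) [] = sym (*-zeroʳ (suc n * 0))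
m*totalOverlap≡n*∣I∣*binomial (suc m) (suc n) I  = begin
  suc m * totalOverlap (suc m) (suc n) I    ≡⟨ cong (suc m *_) (totalOverlap≡∣I∣*binomial m n I) ⟩
  suc m * (∣ I ∣ * binomial m n)            ≡⟨ *-left-comm (suc m) ∣ I ∣ (binomial m n) ⟩
  ∣ I ∣ * (suc m * binomial m n)            ≡⟨ cong (∣ I ∣ *_) (binomial-absorption m n) ⟨
  ∣ I ∣ * (suc n * binomial (suc m) (suc n)) ≡⟨ *-left-comm ∣ I ∣ (suc n) (binomial (suc m) (suc n)) ⟩
  suc n * (∣ I ∣ * binomial (suc m) (suc n)) ≡⟨ *-assoc (suc n) ∣ I ∣ (binomial (suc m) (suc n)) ⟨
  suc n * ∣ I ∣ * binomial (suc m) (suc n)   ∎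
  where open ≡-Reasoning

totalOverlap≤ : ∀ m n d (I : Subset m) →
                totalOverlap m n I ≤ d * binomial m n + n * goodCount m n d I
totalOverlap≤ m n d I = ∑-≤-filter-split (λ V → d <? ∣ V ∩ I ∣) (λ V → ∣ V ∩ I ∣) (λ _ → ≮⇒≥)
  (nSubsets m n) (All.map (λ {V} → ∣V∩I∣≤n V) (all-filter (λ V → ∣ V ∣ ≟ n) (allSubsets m)))
  where
  ∣V∩I∣≤n : ∀ V → ∣ V ∣ ≡ n → ∣ V ∩ I ∣ ≤ n
  ∣V∩I∣≤n V refl = ∣p∩q∣≤∣p∣ V I

binomial≤m*n*goodCount : ∀ m n d (I : Subset m) → d * m < n * ∣ I ∣ →
                         binomial m n ≤ m * n * goodCount m n d I
binomial≤m*n*goodCount m n d I dense = +-cancelˡ-≤ (d * m * C) _ _ (begin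
  d * m * C + C               ≡⟨ +-comm (d * m * C) C ⟩
  suc (d * m) * C             ≤⟨ *-monoˡ-≤ C dense ⟩
  n * ∣ I ∣ * C               ≡⟨ m*totalOverlap≡n*∣I∣*binomial m n I ⟨
  m * totalOverlap m n I      ≤⟨ *-monoʳ-≤ m (totalOverlap≤ m n d I) ⟩
  m * (d * C + n * G)         ≡⟨ expand m d n C G ⟩
  d * m * C + m * n * G       ∎)
  where
  open ≤-Reasoning
  C G : ℕ
  C = binomial m n
  G = goodCount m n d I
  expand : ∀ m d n c g → m * (d * c + n * g) ≡ d * m * c + m * n * g
  expand = solve-∀

n≤2*n^2 : ∀ n → n ≤ 2 * n ^ 2
n≤2*n^2 zero        = z≤n
n≤2*n^2 n@(suc _)   = ≤-trans (m≤m*n n (n * 1)) (m≤m+n (n ^ 2) (n ^ 2 + 0))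

mainTheorem6 : ∀ {a ℓ} (X : Set a) (T : Pred X ℓ) (T? : Decidable T)
               (m n d : ℕ) (u : Fin m → X) →
               n ≤ m →
               d * m < n * ∣ inliers T T? u ∣ →
               length (nSubsets m n) ≤ 2 * n ^ 2 * m * goodCount m n d (inliers T T? u)
mainTheorem6 X T T? m n d u _ dense = begin
  binomial m n       ≤⟨ binomial≤m*n*goodCount m n d I dense ⟩
  m * n * G          ≤⟨ *-monoˡ-≤ G (≤-trans (≤-reflexive (*-comm m n)) (*-monoˡ-≤ m (n≤2*n^2 n))) ⟩
  2 * n ^ 2 * m * G  ∎
  where
  open ≤-Reasoning
  I : Subset m
  I = inliers T T? u
  G : ℕ
  G = goodCount m n d I
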